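{- For $n\in\mathbb{N}\cup\{0\}$, \begin{align*} \sum_{m=0}^{n} \left[\begin{matrix} n\\ m\end{matrix}\right]_q \frac{(-\lambda/a;q)_m\,a^mq^{m(m+1)/2}}{(-bq;q)_m} = \frac{(-aq;q)_n}{(-bq;q)_n} \sum_{m=0}^{n} \left[\begin{matrix} n\\ m\end{matrix}\right]_q \frac{(-\lambda/b;q)_m\,b^mq^{m(m+1)/2}}{(-aq;q)_m}. \end{align*}
   Context: Here $|q|<1$, $(x;q)_0=1$, $(x;q)_n=(1-x)(1-xq)\cdots(1-xq^{n-1})$, and the Gaussian polynomial is $\left[\begin{matrix} N\\ n\end{matrix}\right]_q=\frac{(q;q)_N}{(q;q)_n(q;q)_{N-n}}$ if $0\le n\le N$ and $0$ otherwise. -}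

module Defs where

open import Level using (Level; _⊔_) renaming (suc to lsuc)
open import Algebra.Bundles using (CommutativeRing)
open import Data.Nat as ℕ using (ℕ; zero; suc)
open import Relation.Nullary using (¬_; yes; no)

-- A field: a commutative ring with 0 ≠ 1 together with a total inverse
-- operation `inv` that is a two-sided multiplicative inverse on nonzero
-- elements (the value `inv 0#` is fixed to be 0# by convention; it is never
-- used in a meaningful way since the theorem assumes all denominators nonzero).
record Field (c ℓ : Level) : Set (lsuc (c ⊔ ℓ)) where
  field
    commutativeRing : CommutativeRing c ℓ
  open CommutativeRing commutativeRing public
  field
    inv       : Carrier → Carrier
    inv-cong  : ∀ {x y} → x ≈ y → inv x ≈ inv y
    0≉1       : ¬ (0# ≈ 1#)
    inverseʳ  : ∀ x → ¬ (x ≈ 0#) → x * inv x ≈ 1#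
    inv-zero  : inv 0# ≈ 0#

module FieldOps {c ℓ : Level} (F : Field c ℓ) where
  open Field F hiding (zero)

  _÷_ : Carrier → Carrier → Carrier
  x ÷ y = x * inv y

  pow : Carrier → ℕ → Carrier
  pow x zero    = 1#
  pow x (suc n) = pow x n * x

  poch : Carrier → Carrier → ℕ → Carrier
  poch x q zero    = 1#
  poch x q (suc n) = poch x q n * (1# - x * pow q n)

  gauss : Carrier → ℕ → ℕ → Carrier
  gauss q N n with n ℕ.≤? N
  ... | yes _ =
          poch q q N ÷ (poch q q n * poch q q (N ℕ.∸ n))
  ... | no _ = 0#

  sumTo : ℕ → (ℕ → Carrier) → Carrier
  sumTo zero    f = f zero
  sumTo (suc n) f = sumTo n f + f (suc n)

-- Multiplying by (-bq;q)_n turns the left-hand side into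
--   T_n(a,b,λ) = Σ_m [n m]_q q^{m(m+1)/2} Π_{k<m} (a + λq^k) Π_{i=m+1}^{n} (1 + bq^i)
-- and the right-hand side into T_n(b,a,λ), so the theorem says that T_n is symmetric in a and b.
-- The q-Pascal rule gives T_{n+1}(x,y,λ) = T_n(x,y,λ) + q^{n+1} Δ_n(x,y,λ), where
-- Δ_n(x,y,λ) = y T_n(x,y,λ) + (x+λ) T_n(x,yq,λq).  Given symmetry at n, Δ_n(y,x,λ) equals
-- Δ′_n(x,y,λ) = x T_n(x,y,λ) + (y+λ) T_n(xq,y,λq), so symmetry at n+1 follows from Δ_n = Δ′_n,
-- which holds because Δ_n and Δ′_n satisfy the same first-order recurrence in n.
-- All of this is subtraction-free and holds in any commutative semiring; subtraction and division
-- are needed only to identify the Gaussian polynomial with the q-Pascal coefficients and to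
-- clear denominators.
module Submission where

open import Defs
open import Level using (Level)
open import Algebra.Bundles using (CommutativeSemiring)
open import Data.Empty using (⊥-elim)
open import Data.Nat as ℕ using (ℕ; zero; suc; _≤_; _<_; _∸_; s≤s)
import Data.Nat.Properties as ℕₚ
open import Data.Nat.DivMod using (+-distrib-/-∣ʳ; m*n/n≡m)
open import Data.Nat.Divisibility using (divides-refl)
open import Relation.Binary.PropositionalEquality as ≡ using (_≡_)
open import Relation.Nullary using (¬_; yes; no)

triangular : ℕ → ℕ
triangular m = m ℕ.* suc m ℕ./ 2

triangular-suc : ∀ m → triangular (suc m) ≡ triangular m ℕ.+ suc m
triangular-suc m = begin
  suc m ℕ.* suc (suc m) ℕ./ 2             ≡⟨ ≡.cong (ℕ._/ 2) (expand m) ⟩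
  (m ℕ.* suc m ℕ.+ suc m ℕ.* 2) ℕ./ 2      ≡⟨ +-distrib-/-∣ʳ (m ℕ.* suc m) (divides-refl (suc m)) ⟩
  triangular m ℕ.+ suc m ℕ.* 2 ℕ./ 2       ≡⟨ ≡.cong (triangular m ℕ.+_) (m*n/n≡m (suc m) 2) ⟩
  triangular m ℕ.+ suc m                   ∎
  where
  open ≡.≡-Reasoning
  open import Data.Nat.Tactic.RingSolver using (solve-∀)
  expand : ∀ m → suc m ℕ.* suc (suc m) ≡ m ℕ.* suc m ℕ.+ suc m ℕ.* 2
  expand = solve-∀

module QBinomialSums {c ℓ} (R : CommutativeSemiring c ℓ) where
  open CommutativeSemiring R hiding (zero)
  open import Algebra.Definitions.RawSemiring rawSemiring public using (_^_)
  open import Algebra.Properties.Semiring.Exp semiring using (^-homo-*)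
  open import Algebra.Properties.CommutativeSemigroup +-commutativeSemigroup using (interchange)
  open import Algebra.Properties.CommutativeSemigroup *-commutativeSemigroup
    using (x∙yz≈y∙xz; xy∙z≈y∙xz; x∙yz≈z∙xy)
  open import Algebra.Solver.Ring.NaturalCoefficients.Default R
  open import Relation.Binary.Reasoning.Setoid setoid

  sumUpTo : ℕ → (ℕ → Carrier) → Carrier
  sumUpTo zero    f = f zero
  sumUpTo (suc n) f = sumUpTo n f + f (suc n)

  syntax sumUpTo n (λ m → e) = ∑[ m ≤ n ] e

  ∑-cong : ∀ n {f g : ℕ → Carrier} → (∀ m → m ≤ n → f m ≈ g m) → sumUpTo n f ≈ sumUpTo n g
  ∑-cong zero    f≈g = f≈g 0 ℕ.z≤n
  ∑-cong (suc n) f≈g =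
    +-cong (∑-cong n (λ m m≤n → f≈g m (ℕₚ.m≤n⇒m≤1+n m≤n))) (f≈g (suc n) ℕₚ.≤-refl)

  ∑-distrib-+ : ∀ n (f g : ℕ → Carrier) → ∑[ m ≤ n ] (f m + g m) ≈ sumUpTo n f + sumUpTo n g
  ∑-distrib-+ zero    f g = refl
  ∑-distrib-+ (suc n) f g = trans (+-congʳ (∑-distrib-+ n f g)) (interchange _ _ _ _)

  *-distribˡ-∑ : ∀ n x (f : ℕ → Carrier) → ∑[ m ≤ n ] (x * f m) ≈ x * sumUpTo n f
  *-distribˡ-∑ zero    x f = refl
  *-distribˡ-∑ (suc n) x f = trans (+-congʳ (*-distribˡ-∑ n x f)) (sym (distribˡ x _ _))

  ∑-head : ∀ n (f : ℕ → Carrier) → sumUpTo (suc n) f ≈ f 0 + ∑[ m ≤ n ] f (suc m)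
  ∑-head zero    f = refl
  ∑-head (suc n) f = trans (+-congʳ (∑-head n f)) (+-assoc _ _ _)

  module _ (q : Carrier) where

    ^-+-≡ : ∀ i j {k} → i ℕ.+ j ≡ k → q ^ i * q ^ j ≈ q ^ k
    ^-+-≡ i j ≡.refl = sym (^-homo-* q i j)

    qbinom : ℕ → ℕ → Carrier
    qbinom n       zero    = 1#
    qbinom zero    (suc m) = 0#
    qbinom (suc n) (suc m) = qbinom n (suc m) + q ^ (n ∸ m) * qbinom n m

    qbinom-over : ∀ {n m} → n < m → qbinom n m ≈ 0#
    qbinom-over {zero}  {suc m} _         = refl
    qbinom-over {suc n} {suc m} (s≤s n<m) = begin
      qbinom n (suc m) + q ^ (n ∸ m) * qbinom n m
        ≈⟨ +-cong (qbinom-over (ℕₚ.m≤n⇒m≤1+n n<m)) (*-congˡ (qbinom-over n<m)) ⟩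
      0# + q ^ (n ∸ m) * 0#
        ≈⟨ trans (+-identityˡ _) (zeroʳ _) ⟩
      0# ∎

    qbinom-diag : ∀ n → qbinom n n ≈ 1#
    qbinom-diag zero    = refl
    qbinom-diag (suc n) = begin
      qbinom n (suc n) + q ^ (n ∸ n) * qbinom n n
        ≈⟨ +-cong (qbinom-over (ℕₚ.n<1+n n))
                  (*-cong (reflexive (≡.cong (q ^_) (ℕₚ.n∸n≡0 n))) (qbinom-diag n)) ⟩
      0# + 1# * 1#
        ≈⟨ trans (+-identityˡ _) (*-identityˡ _) ⟩
      1# ∎

    ∑-qbinom-suc : ∀ n (f : ℕ → ℕ → Carrier) →
      ∑[ m ≤ suc n ] (qbinom (suc n) m * f m (suc n ∸ m))
      ≈ ∑[ m ≤ n ] (qbinom n m * f m (suc n ∸ m))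
        + ∑[ m ≤ n ] (q ^ (n ∸ m) * qbinom n m * f (suc m) (n ∸ m))
    ∑-qbinom-suc n f = begin
      ∑[ m ≤ suc n ] (qbinom (suc n) m * f m (suc n ∸ m))
        ≈⟨ ∑-head n _ ⟩
      g 0 + ∑[ m ≤ n ] ((qbinom n (suc m) + q ^ (n ∸ m) * qbinom n m) * f (suc m) (n ∸ m))
        ≈⟨ +-congˡ (trans (∑-cong n (λ m _ → distribʳ _ _ _)) (∑-distrib-+ n _ _)) ⟩
      g 0 + (∑[ m ≤ n ] g (suc m) + shifted)
        ≈⟨ +-assoc _ _ _ ⟨
      (g 0 + ∑[ m ≤ n ] g (suc m)) + shifted
        ≈⟨ +-congʳ (∑-head n g) ⟨
      (sumUpTo n g + g (suc n)) + shifted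
        ≈⟨ +-congʳ (trans (+-congˡ (trans (*-congʳ (qbinom-over (ℕₚ.n<1+n n))) (zeroˡ _)))
                          (+-identityʳ _)) ⟩
      sumUpTo n g + shifted ∎
      where
      g : ℕ → Carrier
      g m = qbinom n m * f m (suc n ∸ m)
      shifted : Carrier
      shifted = ∑[ m ≤ n ] (q ^ (n ∸ m) * qbinom n m * f (suc m) (n ∸ m))

    -- hpoch x l m = x^m (-l/x;q)_m, defined without dividing by x.
    hpoch : Carrier → Carrier → ℕ → Carrier
    hpoch x l zero    = 1#
    hpoch x l (suc m) = hpoch x l m * (x + l * q ^ m)

    hpoch-cong : ∀ {x x′ l l′} m → x ≈ x′ → l ≈ l′ → hpoch x l m ≈ hpoch x′ l′ m
    hpoch-cong zero    _    _    = refl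
    hpoch-cong (suc m) x≈x′ l≈l′ = *-cong (hpoch-cong m x≈x′ l≈l′) (+-cong x≈x′ (*-congʳ l≈l′))

    hpoch-+ : ∀ x l m k → hpoch x l (m ℕ.+ k) ≈ hpoch x l m * hpoch x (l * q ^ m) k
    hpoch-+ x l m zero    rewrite ℕₚ.+-identityʳ m = sym (*-identityʳ _)
    hpoch-+ x l m (suc k) rewrite ℕₚ.+-suc m k = begin
      hpoch x l (m ℕ.+ k) * (x + l * q ^ (m ℕ.+ k))
        ≈⟨ *-cong (hpoch-+ x l m k) (+-congˡ (trans (*-congˡ (^-homo-* q m k)) (sym (*-assoc l _ _)))) ⟩
      hpoch x l m * hpoch x (l * q ^ m) k * (x + l * q ^ m * q ^ k)
        ≈⟨ *-assoc _ _ _ ⟩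
      hpoch x l m * hpoch x (l * q ^ m) (suc k) ∎

    hpoch-suc′ : ∀ x l m → hpoch x l (suc m) ≈ (x + l) * hpoch x (l * q) m
    hpoch-suc′ x l m = trans (hpoch-+ x l 1 m)
      (*-cong (trans (*-identityˡ _) (+-congˡ (*-identityʳ l)))
              (hpoch-cong m refl (*-congˡ (*-identityʳ q))))

    hpoch-scale : ∀ a x l m → hpoch (a * x) (a * l) m ≈ a ^ m * hpoch x l m
    hpoch-scale a x l zero    = sym (*-identityˡ 1#)
    hpoch-scale a x l (suc m) = trans (*-congʳ (hpoch-scale a x l m))
      (solve 6 (λ a x l p A H → A :* H :* (a :* x :+ a :* l :* p) := a :* A :* (H :* (x :+ l :* p)))
             refl a x l (q ^ m) (a ^ m) (hpoch x l m))

    weight : Carrier → Carrier → Carrier → ℕ → ℕ → Carrier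
    weight x y l m k = hpoch x l m * q ^ triangular m * hpoch 1# (y * q ^ suc m) k

    T : ℕ → Carrier → Carrier → Carrier → Carrier
    T n x y l = ∑[ m ≤ n ] (qbinom n m * weight x y l m (n ∸ m))

    Δ Δ′ : ℕ → Carrier → Carrier → Carrier → Carrier
    Δ  n x y l = y * T n x y l + (x + l) * T n x (y * q) (l * q)
    Δ′ n x y l = x * T n x y l + (y + l) * T n (x * q) y (l * q)

    T-zero : ∀ x y l → T 0 x y l ≈ 1#
    T-zero x y l = trans (*-identityˡ _) (trans (*-identityʳ _) (*-identityˡ _))

    weight-last : ∀ x y l {m n} → m ≤ n →
      weight x y l m (suc n ∸ m) ≈ (1# + y * q ^ suc n) * weight x y l m (n ∸ m)
    weight-last x y l {m} {n} m≤n = begin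
      H * Q * hpoch 1# w (suc n ∸ m)
        ≡⟨ ≡.cong (λ k → H * Q * hpoch 1# w k) (ℕₚ.+-∸-assoc 1 m≤n) ⟩
      H * Q * (P * (1# + w * q ^ (n ∸ m)))
        ≈⟨ *-congˡ (*-congˡ (+-congˡ (trans (*-assoc y _ _)
             (*-congˡ (^-+-≡ (suc m) (n ∸ m) (≡.cong suc (ℕₚ.m+[n∸m]≡n m≤n))))))) ⟩
      H * Q * (P * (1# + y * q ^ suc n))
        ≈⟨ x∙yz≈z∙xy _ _ _ ⟩
      (1# + y * q ^ suc n) * (H * Q * P) ∎
      where
      w = y * q ^ suc m
      H = hpoch x l m
      Q = q ^ triangular m
      P = hpoch 1# w (n ∸ m)

    weight-first : ∀ x y l {m n} → m ≤ n →
      q ^ (n ∸ m) * weight x y l (suc m) (n ∸ m) ≈ q ^ suc n * (x + l) * weight x (y * q) (l * q) m (n ∸ m)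
    weight-first x y l {m} {n} m≤n = begin
      q ^ (n ∸ m) * (hpoch x l (suc m) * q ^ triangular (suc m) * hpoch 1# (y * q ^ suc (suc m)) (n ∸ m))
        ≈⟨ *-congˡ (*-cong (*-cong (hpoch-suc′ x l m)
                                   (sym (^-+-≡ (triangular m) (suc m) (≡.sym (triangular-suc m)))))
                           (hpoch-cong (n ∸ m) refl (sym (*-assoc y q _)))) ⟩
      q ^ (n ∸ m) * ((x + l) * H * (Q * q ^ suc m) * P)
        ≈⟨ solve 6 (λ a s H Q b P → a :* (s :* H :* (Q :* b) :* P) := a :* b :* s :* (H :* Q :* P))
                 refl (q ^ (n ∸ m)) (x + l) H Q (q ^ suc m) P ⟩
      q ^ (n ∸ m) * q ^ suc m * (x + l) * (H * Q * P)
        ≈⟨ *-congʳ (*-congʳ (^-+-≡ (n ∸ m) (suc m)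
                               (≡.trans (ℕₚ.+-suc (n ∸ m) m) (≡.cong suc (ℕₚ.m∸n+n≡m m≤n))))) ⟩
      q ^ suc n * (x + l) * (H * Q * P) ∎
      where
      H = hpoch x (l * q) m
      Q = q ^ triangular m
      P = hpoch 1# (y * q * q ^ suc m) (n ∸ m)

    T-suc : ∀ n x y l → T (suc n) x y l ≈ T n x y l + q ^ suc n * Δ n x y l
    T-suc n x y l = begin
      T (suc n) x y l
        ≈⟨ ∑-qbinom-suc n (weight x y l) ⟩
      ∑[ m ≤ n ] (qbinom n m * weight x y l m (suc n ∸ m))
        + ∑[ m ≤ n ] (q ^ (n ∸ m) * qbinom n m * weight x y l (suc m) (n ∸ m))
        ≈⟨ +-cong (∑-cong n (λ m m≤n → trans (*-congˡ (weight-last x y l m≤n)) (x∙yz≈y∙xz _ _ _)))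
                  (∑-cong n (λ m m≤n → trans (xy∙z≈y∙xz _ _ _)
                                         (trans (*-congˡ (weight-first x y l m≤n)) (x∙yz≈y∙xz _ _ _)))) ⟩
      ∑[ m ≤ n ] (A * (qbinom n m * weight x y l m (n ∸ m)))
        + ∑[ m ≤ n ] (B * (qbinom n m * weight x (y * q) (l * q) m (n ∸ m)))
        ≈⟨ +-cong (*-distribˡ-∑ n A _) (*-distribˡ-∑ n B _) ⟩
      A * T n x y l + B * T n x (y * q) (l * q)
        ≈⟨ solve 6 (λ x y l Q t t′ → (con 1 :+ y :* Q) :* t :+ Q :* (x :+ l) :* t′
                                   := t :+ Q :* (y :* t :+ (x :+ l) :* t′))
                 refl x y l (q ^ suc n) (T n x y l) (T n x (y * q) (l * q)) ⟩
      T n x y l + q ^ suc n * Δ n x y l ∎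
      where
      A B : Carrier
      A = 1# + y * q ^ suc n
      B = q ^ suc n * (x + l)

    Δ-suc : ∀ n x y l →
      Δ (suc n) x y l ≈ (1# + y * q ^ suc n) * Δ n x y l + q ^ suc n * (x + l) * Δ n x (y * q) (l * q)
    Δ-suc n x y l = trans (+-cong (*-congˡ (T-suc n x y l)) (*-congˡ (T-suc n x (y * q) (l * q))))
      (solve 7 (λ x y l Q t t′ d′ →
                  y :* (t :+ Q :* (y :* t :+ (x :+ l) :* t′)) :+ (x :+ l) :* (t′ :+ Q :* d′)
               := (con 1 :+ y :* Q) :* (y :* t :+ (x :+ l) :* t′) :+ Q :* (x :+ l) :* d′)
             refl x y l (q ^ suc n) (T n x y l) (T n x (y * q) (l * q)) (Δ n x (y * q) (l * q)))

    Δ′-suc : ∀ n x y l →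
      Δ′ (suc n) x y l ≈ (1# + y * q ^ suc n) * Δ′ n x y l + q ^ suc n * (x + l) * Δ′ n x (y * q) (l * q)
    Δ′-suc n x y l = trans (+-cong (*-congˡ (T-suc n x y l)) (*-congˡ (T-suc n (x * q) y (l * q))))
      (solve 9 (λ x y l q Q t t′ t″ t‴ →
                  x :* (t :+ Q :* (y :* t :+ (x :+ l) :* t′))
                    :+ (y :+ l) :* (t″ :+ Q :* (y :* t″ :+ (x :* q :+ l :* q) :* t‴))
               := (con 1 :+ y :* Q) :* (x :* t :+ (y :+ l) :* t″)
                    :+ Q :* (x :+ l) :* (x :* t′ :+ (y :* q :+ l :* q) :* t‴))
             refl x y l q (q ^ suc n) (T n x y l) (T n x (y * q) (l * q)) (T n (x * q) y (l * q))
             (T n (x * q) (y * q) (l * q * q)))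

    Δ≈Δ′ : ∀ n x y l → Δ n x y l ≈ Δ′ n x y l
    Δ≈Δ′ zero x y l = begin
      y * T 0 x y l + (x + l) * T 0 x (y * q) (l * q)
        ≈⟨ +-cong (*-congˡ (T-zero x y l)) (*-congˡ (T-zero x (y * q) (l * q))) ⟩
      y * 1# + (x + l) * 1#
        ≈⟨ solve 3 (λ x y l → y :* con 1 :+ (x :+ l) :* con 1 := x :* con 1 :+ (y :+ l) :* con 1) refl x y l ⟩
      x * 1# + (y + l) * 1#
        ≈⟨ +-cong (*-congˡ (T-zero x y l)) (*-congˡ (T-zero (x * q) y (l * q))) ⟨
      x * T 0 x y l + (y + l) * T 0 (x * q) y (l * q) ∎
    Δ≈Δ′ (suc n) x y l = begin
      Δ (suc n) x y l
        ≈⟨ Δ-suc n x y l ⟩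
      (1# + y * q ^ suc n) * Δ n x y l + q ^ suc n * (x + l) * Δ n x (y * q) (l * q)
        ≈⟨ +-cong (*-congˡ (Δ≈Δ′ n x y l)) (*-congˡ (Δ≈Δ′ n x (y * q) (l * q))) ⟩
      (1# + y * q ^ suc n) * Δ′ n x y l + q ^ suc n * (x + l) * Δ′ n x (y * q) (l * q)
        ≈⟨ Δ′-suc n x y l ⟨
      Δ′ (suc n) x y l ∎

    T-sym : ∀ n x y l → T n x y l ≈ T n y x l
    T-sym zero    x y l = refl
    T-sym (suc n) x y l = begin
      T (suc n) x y l                   ≈⟨ T-suc n x y l ⟩
      T n x y l + q ^ suc n * Δ n x y l  ≈⟨ +-congˡ (*-congˡ (Δ≈Δ′ n x y l)) ⟩
      T n x y l + q ^ suc n * Δ′ n x y l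
        ≈⟨ +-cong (T-sym n x y l)
                  (*-congˡ (+-cong (*-congˡ (T-sym n x y l)) (*-congˡ (T-sym n (x * q) y (l * q))))) ⟩
      T n y x l + q ^ suc n * Δ n y x l  ≈⟨ T-suc n y x l ⟨
      T (suc n) y x l                   ∎

module FieldTranslation {c ℓ} (F : Field c ℓ) where
  open Field F hiding (zero)
  open FieldOps F
  open QBinomialSums commutativeSemiring
  open import Algebra.Properties.Ring ring using (-‿distribˡ-*; -‿involutive; x[y-z]≈xy-xz)
  open import Algebra.Solver.Ring.NaturalCoefficients.Default commutativeSemiring
  open import Relation.Binary.Reasoning.Setoid setoid

  ≉0-factorˡ : ∀ {x y} → ¬ (x * y ≈ 0#) → ¬ (x ≈ 0#)
  ≉0-factorˡ xy≉0 x≈0 = xy≉0 (trans (*-congʳ x≈0) (zeroˡ _))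

  ≉0-factorʳ : ∀ {x y} → ¬ (x * y ≈ 0#) → ¬ (y ≈ 0#)
  ≉0-factorʳ xy≉0 y≈0 = xy≉0 (trans (*-congˡ y≈0) (zeroʳ _))

  ÷-cancelʳ : ∀ {d} x → ¬ (d ≈ 0#) → (x * d) ÷ d ≈ x
  ÷-cancelʳ {d} x d≉0 = trans (*-assoc x d (inv d)) (trans (*-congˡ (inverseʳ d d≉0)) (*-identityʳ x))

  cross-multiplied⇒quotient : ∀ {a b u v} → ¬ (b ≈ 0#) → b * u ≈ a * v → u ≈ (a ÷ b) * v
  cross-multiplied⇒quotient {a} {b} {u} {v} b≉0 bu≈av = begin
    u                ≈⟨ ÷-cancelʳ u b≉0 ⟨
    u * b * inv b    ≈⟨ *-congʳ (trans (*-comm u b) bu≈av) ⟩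
    a * v * inv b    ≈⟨ solve 3 (λ a v i → a :* v :* i := a :* i :* v) refl a v (inv b) ⟩
    a * inv b * v    ∎

  [1-x]+x[1-y]≈1-xy : ∀ x y → (1# - x) + x * (1# - y) ≈ 1# - x * y
  [1-x]+x[1-y]≈1-xy x y = begin
    (1# - x) + x * (1# - y)     ≈⟨ +-congˡ (trans (x[y-z]≈xy-xz x 1# y) (+-congʳ (*-identityʳ x))) ⟩
    (1# - x) + (x - x * y)      ≈⟨ +-assoc 1# (- x) _ ⟩
    1# + (- x + (x - x * y))    ≈⟨ +-congˡ (+-assoc (- x) x _) ⟨
    1# + ((- x + x) - x * y)    ≈⟨ +-congˡ (trans (+-congʳ (-‿inverseˡ x)) (+-identityˡ _)) ⟩
    1# - x * y                  ∎

  pow≈^ : ∀ x n → pow x n ≈ x ^ n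
  pow≈^ x zero    = refl
  pow≈^ x (suc n) = trans (*-comm (pow x n) x) (*-congˡ (pow≈^ x n))

  sumTo≈∑ : ∀ n f → sumTo n f ≈ sumUpTo n f
  sumTo≈∑ zero    f = refl
  sumTo≈∑ (suc n) f = +-congʳ (sumTo≈∑ n f)

  poch-neg≈hpoch : ∀ q w n → poch (- w) q n ≈ hpoch q 1# w n
  poch-neg≈hpoch q w zero    = refl
  poch-neg≈hpoch q w (suc n) = *-cong (poch-neg≈hpoch q w n) (+-congˡ (begin
    - (- w * pow q n)   ≈⟨ -‿cong (-‿distribˡ-* w (pow q n)) ⟨
    - - (w * pow q n)   ≈⟨ -‿involutive _ ⟩
    w * pow q n         ≈⟨ *-congˡ (pow≈^ q n) ⟩
    w * q ^ n           ∎))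

  poch-neg-split : ∀ q y {m n} → m ≤ n →
    poch (- (y * q)) q n ≈ poch (- (y * q)) q m * hpoch q 1# (y * q ^ suc m) (n ∸ m)
  poch-neg-split q y {m} {n} m≤n = begin
    poch (- (y * q)) q n
      ≈⟨ poch-neg≈hpoch q (y * q) n ⟩
    hpoch q 1# (y * q) n
      ≡⟨ ≡.cong (hpoch q 1# (y * q)) (ℕₚ.m+[n∸m]≡n m≤n) ⟨
    hpoch q 1# (y * q) (m ℕ.+ (n ∸ m))
      ≈⟨ hpoch-+ q 1# (y * q) m (n ∸ m) ⟩
    hpoch q 1# (y * q) m * hpoch q 1# (y * q * q ^ m) (n ∸ m)
      ≈⟨ *-cong (poch-neg≈hpoch q (y * q) m) (hpoch-cong q (n ∸ m) refl (sym (*-assoc y q (q ^ m)))) ⟨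
    poch (- (y * q)) q m * hpoch q 1# (y * q ^ suc m) (n ∸ m) ∎

  poch-homogenised : ∀ q {x} l m → ¬ (x ≈ 0#) → poch (- (l ÷ x)) q m * pow x m ≈ hpoch q x l m
  poch-homogenised q {x} l m x≉0 = begin
    poch (- (l * inv x)) q m * pow x m      ≈⟨ *-cong (poch-neg≈hpoch q _ m) (pow≈^ x m) ⟩
    hpoch q 1# (l * inv x) m * x ^ m        ≈⟨ *-comm _ _ ⟩
    x ^ m * hpoch q 1# (l * inv x) m        ≈⟨ hpoch-scale q x 1# (l * inv x) m ⟨
    hpoch q (x * 1#) (x * (l * inv x)) m    ≈⟨ hpoch-cong q m (*-identityʳ x) x[l/x]≈l ⟩
    hpoch q x l m                           ∎
    where
    x[l/x]≈l : x * (l * inv x) ≈ l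
    x[l/x]≈l = trans (solve 3 (λ x l i → x :* (l :* i) := l :* (x :* i)) refl x l (inv x))
                     (trans (*-congˡ (inverseʳ x x≉0)) (*-identityʳ l))

  qbinom-qfactorial : ∀ q m k → qbinom q (m ℕ.+ k) m * (poch q q m * poch q q k) ≈ poch q q (m ℕ.+ k)
  qbinom-qfactorial q zero    k = trans (*-identityˡ _) (*-identityˡ _)
  qbinom-qfactorial q (suc m) zero rewrite ℕₚ.+-identityʳ m =
    trans (*-congʳ (qbinom-diag q (suc m))) (trans (*-identityˡ _) (*-identityʳ _))
  qbinom-qfactorial q (suc m) (suc k) = begin
    (qbinom q N (suc m) + q ^ (N ∸ m) * qbinom q N m) * (poch q q m * u * (poch q q k * v))
      ≈⟨ solve 7 (λ b₁ a b₂ pm u pk v → (b₁ :+ a :* b₂) :* (pm :* u :* (pk :* v))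
                                      := b₁ :* (pm :* u :* pk) :* v :+ a :* (b₂ :* (pm :* (pk :* v))) :* u)
               refl (qbinom q N (suc m)) (q ^ (N ∸ m)) (qbinom q N m) (poch q q m) u (poch q q k) v ⟩
    qbinom q N (suc m) * (poch q q (suc m) * poch q q k) * v
      + q ^ (N ∸ m) * (qbinom q N m * (poch q q m * poch q q (suc k))) * u
      ≈⟨ +-cong (*-congʳ shorter) (*-congʳ (*-cong (reflexive (≡.cong (q ^_) (ℕₚ.m+n∸m≡n m (suc k))))
                                                   (qbinom-qfactorial q m (suc k)))) ⟩
    poch q q N * v + q ^ suc k * poch q q N * u
      ≈⟨ solve 4 (λ p v a u → p :* v :+ a :* p :* u := p :* (v :+ a :* u)) refl (poch q q N) v (q ^ suc k) u ⟩
    poch q q N * (v + q ^ suc k * u)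
      ≈⟨ *-congˡ (+-cong (+-congˡ (-‿cong (*-congˡ (pow≈^ q k))))
                         (*-congˡ (+-congˡ (-‿cong (*-congˡ (pow≈^ q m)))))) ⟩
    poch q q N * ((1# - q ^ suc k) + q ^ suc k * (1# - q ^ suc m))
      ≈⟨ *-congˡ ([1-x]+x[1-y]≈1-xy (q ^ suc k) (q ^ suc m)) ⟩
    poch q q N * (1# - q ^ suc k * q ^ suc m)
      ≈⟨ *-congˡ (+-congˡ (-‿cong (trans (^-+-≡ q (suc k) (suc m) (ℕₚ.+-comm (suc k) (suc m)))
                                         (*-congˡ (sym (pow≈^ q N)))))) ⟩
    poch q q N * (1# - q * pow q N) ∎
    where
    N = m ℕ.+ suc k
    u = 1# - q * pow q m
    v = 1# - q * pow q k
    shorter : qbinom q N (suc m) * (poch q q (suc m) * poch q q k) ≈ poch q q N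
    shorter = ≡.subst (λ j → qbinom q j (suc m) * (poch q q (suc m) * poch q q k) ≈ poch q q j)
                      (≡.sym (ℕₚ.+-suc m k)) (qbinom-qfactorial q (suc m) k)

  gauss≈qbinom : ∀ q {n m} → m ≤ n → ¬ (poch q q n ≈ 0#) → gauss q n m ≈ qbinom q n m
  gauss≈qbinom q {n} {m} m≤n qfac≉0 with m ℕ.≤? n
  ... | no  m≰n = ⊥-elim (m≰n m≤n)
  ... | yes _   = begin
    poch q q n ÷ D            ≈⟨ *-congʳ factorisation ⟨
    (qbinom q n m * D) ÷ D    ≈⟨ ÷-cancelʳ _ D≉0 ⟩
    qbinom q n m              ∎
    where
    D = poch q q m * poch q q (n ∸ m)
    factorisation : qbinom q n m * D ≈ poch q q n
    factorisation = ≡.subst (λ j → qbinom q j m * D ≈ poch q q j) (ℕₚ.m+[n∸m]≡n m≤n)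
                            (qbinom-qfactorial q m (n ∸ m))
    D≉0 : ¬ (D ≈ 0#)
    D≉0 = ≉0-factorʳ (λ qD≈0 → qfac≉0 (trans (sym factorisation) qD≈0))

  clear-denominator : ∀ q x y l n → ¬ (x ≈ 0#) → ¬ (poch q q n ≈ 0#) → ¬ (poch (- (y * q)) q n ≈ 0#) →
    poch (- (y * q)) q n
      * sumTo n (λ m → gauss q n m
                       * ((poch (- (l ÷ x)) q m * pow x m * pow q (triangular m)) ÷ poch (- (y * q)) q m))
    ≈ T q n x y l
  clear-denominator q x y l n x≉0 qfac≉0 B≉0 = begin
    B * sumTo n summand      ≈⟨ *-congˡ (sumTo≈∑ n summand) ⟩
    B * sumUpTo n summand    ≈⟨ *-distribˡ-∑ n B summand ⟨
    ∑[ m ≤ n ] (B * summand m) ≈⟨ ∑-cong n cleared ⟩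
    T q n x y l              ∎
    where
    B = poch (- (y * q)) q n
    summand : ℕ → Carrier
    summand m = gauss q n m * ((poch (- (l ÷ x)) q m * pow x m * pow q (triangular m)) ÷ poch (- (y * q)) q m)
    cleared : ∀ m → m ≤ n → B * summand m ≈ qbinom q n m * weight q x y l m (n ∸ m)
    cleared m m≤n = begin
      B * summand m
        ≈⟨ *-cong (poch-neg-split q y m≤n)
                  (*-cong (gauss≈qbinom q m≤n qfac≉0)
                          (*-congʳ (*-cong (poch-homogenised q l m x≉0) (pow≈^ q (triangular m))))) ⟩
      Bₘ * P * (G * (H * Q * inv Bₘ))
        ≈⟨ solve 6 (λ b P G H Q i → b :* P :* (G :* (H :* Q :* i)) := G :* (H :* Q :* P) :* (b :* i))
                 refl Bₘ P G H Q (inv Bₘ) ⟩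
      G * (H * Q * P) * (Bₘ * inv Bₘ)
        ≈⟨ trans (*-congˡ (inverseʳ Bₘ Bₘ≉0)) (*-identityʳ _) ⟩
      G * (H * Q * P) ∎
      where
      Bₘ = poch (- (y * q)) q m
      Bₘ≉0 : ¬ (Bₘ ≈ 0#)
      Bₘ≉0 = ≉0-factorˡ (λ eq → B≉0 (trans (poch-neg-split q y m≤n) eq))
      P = hpoch q 1# (y * q ^ suc m) (n ∸ m)
      G = qbinom q n m
      H = hpoch q x l m
      Q = q ^ triangular m

theorem2p5 : {c ℓ : Level} (F : Field c ℓ) →
    let open Field F
        open FieldOps F
    in (q a b λ′ : Carrier) (n : ℕ) →
       ¬ (a ≈ 0#) → ¬ (b ≈ 0#) →
       ¬ (poch q q n ≈ 0#) →
       ¬ (poch (- (a * q)) q n ≈ 0#) →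
       ¬ (poch (- (b * q)) q n ≈ 0#) →
       sumTo n (λ m → gauss q n m
                       * ((poch (- (λ′ ÷ a)) q m * pow a m * pow q ((m ℕ.* suc m) ℕ./ 2))
                          ÷ poch (- (b * q)) q m))
       ≈ (poch (- (a * q)) q n ÷ poch (- (b * q)) q n)
         * sumTo n (λ m → gauss q n m
                       * ((poch (- (λ′ ÷ b)) q m * pow b m * pow q ((m ℕ.* suc m) ℕ./ 2))
                          ÷ poch (- (a * q)) q m))
theorem2p5 F q a b λ′ n a≉0 b≉0 qfac≉0 A≉0 B≉0 = cross-multiplied⇒quotient B≉0 (begin
  _               ≈⟨ clear-denominator q a b λ′ n a≉0 qfac≉0 B≉0 ⟩
  T q n a b λ′    ≈⟨ T-sym q n a b λ′ ⟩
  T q n b a λ′    ≈⟨ clear-denominator q b a λ′ n b≉0 qfac≉0 A≉0 ⟨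
  _               ∎)
  where
  open Field F using (setoid)
  open FieldTranslation F
  open QBinomialSums (Field.commutativeSemiring F) using (T; T-sym)
  open import Relation.Binary.Reasoning.Setoid setoid
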